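{- Let $g:S\to F$ be such that the function $f:K\to\mathbb{F}_2$, $f(\lambda u)=tr(\lambda g(u))$ ($\lambda\in F$, $u\in S$), is bent, and let $\mathcal{O}=\{L(u,g(u)):u\in S\}$ be its corresponding line oval. Let $c\in K$, define $f_c(x)=f(x)+Tr(cx)$, and let $\mathcal{O}_c=\tau_c\mathcal{O}=\{\tau_c(L):L\in\mathcal{O}\}$, where $\tau_c:K\to K$, $x\mapsto x+c$. Then the dual of $f_c$ is $\widetilde{f_c}=1+\chi_{E(\mathcal{O}_c)}$.
   Context: Let $m\ge1$, $q=2^m$, $F=\mathbb{F}_{q}\subseteq K=\mathbb{F}_{q^2}$, $\bar x=x^q$, $T(x)=x+\bar x$, $tr:F\to\mathbb{F}_2$ and $Tr:K\to\mathbb{F}_2$ absolute traces, $S=\{u\in K:u\bar u=1\}$ (every nonzero $x\in K$ is uniquely $\lambda u$, $\lambda\in F^*$, $u\in S$). $K$ is the affine plane $AG(2,q)$ with lines $L(u,\mu)=\{x\in K:T(ux)+\mu=0\}$, $u\in S$, $\mu\in F$. A line oval in $K$ is a set of $q+1$ lines, pairwise non-parallel, no three through a common point; $E(\mathcal{O})$ is the set of points on at least one line of $\mathcal{O}$, $\chi_{E(\mathcal{O})}$ its characteristic function. $f$ is bent if $W_f(b)=\sum_{x\in K}(-1)^{f(x)+Tr(bx)}=\pm q$ for all $b$, with dual $\tilde f$ given by $W_f(b)=(-1)^{\tilde f(b)}q$. (For bent $f$ as in the claim, $\{L(u,g(u)):u\in S\}$ is a line oval.) -}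

module Defs where

open import Level using (0ℓ)
open import Data.Nat as ℕ using (ℕ; zero; suc)
open import Data.Bool using (Bool; true; false; _xor_)
open import Data.Integer as ℤ using (ℤ)
open import Data.List using (List; []; _∷_; map; length; foldr)
open import Data.List.Membership.Propositional using (_∈_)
open import Data.List.Relation.Unary.Unique.Propositional using (Unique)
open import Data.Product using (Σ; ∃; _×_)
open import Data.Sum using (_⊎_)
open import Relation.Binary.PropositionalEquality using (_≡_; _≢_)
open import Relation.Binary.Definitions using (DecidableEquality)
open import Relation.Nullary.Decidable using (Dec; yes; no)
open import Algebra.Structures using (IsCommutativeRing)

-- A finite field of characteristic 2 with exactly 2^(2m) elements, i.e. a model
-- of K = F_{q^2}, q = 2^m.  (Equality is propositional equality; every finite
-- field has such a presentation.)
record FiniteField2 (m : ℕ) : Set₁ where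
  infixl 6 _+_
  infixl 7 _*_
  field
    Carrier : Set
    _+_ _*_ : Carrier → Carrier → Carrier
    -_      : Carrier → Carrier
    0# 1#   : Carrier
    isCommutativeRing : IsCommutativeRing _≡_ _+_ _*_ -_ 0# 1#
    0≢1     : 0# ≢ 1#
    inverse : ∀ x → x ≢ 0# → Σ Carrier (λ y → x * y ≡ 1#)
    char2   : 1# + 1# ≡ 0#
    _≟_     : DecidableEquality Carrier
    elems          : List Carrier
    elems-complete : ∀ x → x ∈ elems
    elems-unique   : Unique elems
    elems-size     : length elems ≡ 2 ℕ.^ (2 ℕ.* m)

qℕ : ℕ → ℕ
qℕ m = 2 ℕ.^ m

module Setup {m : ℕ} (𝕂 : FiniteField2 m) where
  open FiniteField2 𝕂

  _^_ : Carrier → ℕ → Carrier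
  x ^ zero  = 1#
  x ^ suc n = x * (x ^ n)

  conj : Carrier → Carrier
  conj x = x ^ qℕ m

  T : Carrier → Carrier
  T x = x + conj x

  InF : Carrier → Set
  InF x = conj x ≡ x

  InS : Carrier → Set
  InS u = u * conj u ≡ 1#

  traceSum : ℕ → Carrier → Carrier
  traceSum zero    x = 0#
  traceSum (suc n) x = x ^ (2 ℕ.^ n) + traceSum n x

  -- absolute traces, valued in F_2 = {0,1} ⊆ K, read as Bool (true ↔ 1)
  toF2 : Carrier → Bool
  toF2 y with y ≟ 0#
  ... | yes _ = false
  ... | no  _ = true

  -- tr : F → F_2   (applied to elements of F)
  tr : Carrier → Bool
  tr y = toF2 (traceSum m y)

  Tr : Carrier → Bool
  Tr x = toF2 (traceSum (2 ℕ.* m) x)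

  sgn : Bool → ℤ
  sgn false = ℤ.+ 1
  sgn true  = ℤ.- (ℤ.+ 1)

  sumℤ : List ℤ → ℤ
  sumℤ = foldr ℤ._+_ (ℤ.+ 0)

  W : (Carrier → Bool) → Carrier → ℤ
  W f b = sumℤ (map (λ x → sgn (f x xor Tr (b * x))) elems)

  Bent : (Carrier → Bool) → Set
  Bent f = ∀ b → (W f b ≡ ℤ.+ qℕ m) ⊎ (W f b ≡ ℤ.- (ℤ.+ qℕ m))

  OnLine : Carrier → Carrier → Carrier → Set
  OnLine u μ x = T (u * x) + μ ≡ 0#

  τ : Carrier → Carrier → Carrier
  τ c x = x + c

  OnTranslatedLine : Carrier → Carrier → Carrier → Carrier → Set
  OnTranslatedLine c u μ y = Σ Carrier (λ x → OnLine u μ x × y ≡ τ c x)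

  -- y ∈ E(O_c), where O_c = τ_c O and O = { L(u, g u) : u ∈ S }
  InE : (Carrier → Carrier) → Carrier → Carrier → Set
  InE g c y = Σ Carrier (λ u → InS u × OnTranslatedLine c u (g u) y)

-- Every nonzero x is uniquely l u with l ∈ F* and u ∈ S, and on the block F* u the function
-- x ↦ f x + Tr (b x) is l ↦ tr (l a) with a = T (u b) + g u ∈ F. Hence the Walsh sum of f at b
-- is 1 plus one character sum over F* per u ∈ S; by orthogonality of the characters of F,
-- W_f(b) + |S| = 1 + |F| · #{u ∈ S : b ∈ L(u, g u)}. Counting K* = F* S and embedding K into
-- F × F by x ↦ (T x, T (ω x)) for some ω ∉ F give |S| ≤ q + 1, so the only value W_f(b) = ± q
-- compatible with this identity is q if b lies on a line of O and −q otherwise. Finally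
-- W_{f_c}(b) = W_f(b + c), and b + c lies on a line of O iff b lies on a line of τ_c O.

module Submission where

open import Defs
open import Level using (0ℓ)
open import Algebra.Bundles using (CommutativeRing)
import Algebra.Properties.CommutativeSemigroup as CommutativeSemigroupProperties
open import Data.Bool using (Bool; true; false; _xor_)
import Data.Bool.Properties as Bool
open import Data.Empty using (⊥-elim)
open import Data.Nat as ℕ using (ℕ; zero; suc; _≤_; _<_; z≤n; s≤s; NonZero)
import Data.Nat.Properties as ℕ
open import Data.Nat.ListAction using (sum)
import Data.Nat.Tactic.RingSolver as ℕ-Solver
open import Data.Integer as ℤ using (ℤ; -[1+_]) renaming (_+_ to _+ℤ_; -_ to -ℤ_)
import Data.Integer.Properties as ℤ
import Data.Integer.Tactic.RingSolver as ℤ-Solver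
open import Data.List using (List; []; _∷_; map; length; foldr; filter; _++_; cartesianProduct)
open import Data.List.Properties using (length-++; length-map; map-++; map-∘)
open import Data.List.Membership.Propositional using (_∈_; lose)
open import Data.List.Membership.Propositional.Properties
  using (∈-filter⁺; ∈-filter⁻; ∈-++⁺ˡ; ∈-++⁺ʳ; ∈-++⁻; ∈-map⁺; ∈-map⁻; ∈-cartesianProduct⁺)
open import Data.List.Membership.Propositional.Properties.WithK using (unique∧set⇒bag)
import Data.List.Membership.DecPropositional as DecMembership
open import Data.List.Relation.Binary.BagAndSetEquality using (∼bag⇒↭)
open import Data.List.Relation.Binary.Permutation.Propositional using (_↭_; ↭⇒↭ₛ)
open import Data.List.Relation.Binary.Permutation.Propositional.Properties using (↭-length)
import Data.List.Relation.Binary.Permutation.Propositional.Properties as ↭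
open import Data.List.Relation.Binary.Permutation.Setoid.Properties using (foldr-commMonoid)
open import Data.List.Relation.Unary.All as All using ()
open import Data.List.Relation.Unary.AllPairs using ([]; _∷_)
open import Data.List.Relation.Unary.Any using (here; there; any?; satisfied)
open import Data.List.Relation.Unary.Unique.Propositional using (Unique)
import Data.List.Relation.Unary.Unique.Propositional.Properties as Unique
open import Data.Product using (∃; _×_; _,_; proj₁; proj₂)
open import Data.Product.Properties using (≡-dec)
open import Data.Sum using (_⊎_; inj₁; inj₂)
open import Function.Base using (_∘_)
open import Function.Bundles using (mk⇔)
open import Relation.Binary.Definitions using (DecidableEquality)
open import Relation.Binary.PropositionalEquality as ≡
  using (_≡_; _≢_; refl; cong; cong₂; sym; trans; subst; subst₂)
open import Relation.Nullary using (¬_; Dec; yes; no; ¬?; _×-dec_)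
open ≡.≡-Reasoning

module _ {A : Set} where

  unique⇒↭ : {xs ys : List A} → Unique xs → Unique ys →
    (∀ {z} → z ∈ xs → z ∈ ys) → (∀ {z} → z ∈ ys → z ∈ xs) → xs ↭ ys
  unique⇒↭ uxs uys xs⊆ys ys⊆xs = ∼bag⇒↭ (unique∧set⇒bag uxs uys (mk⇔ xs⊆ys ys⊆xs))

  map-↭-self : {xs : List A} (σ : A → A) → (∀ {a b} → σ a ≡ σ b → a ≡ b) → Unique xs →
    (∀ {x} → x ∈ xs → σ x ∈ xs) → (∀ {y} → y ∈ xs → ∃ λ x → x ∈ xs × σ x ≡ y) →
    map σ xs ↭ xs
  map-↭-self {xs} σ σ-injective uxs into onto =
    unique⇒↭ (Unique.map⁺ σ-injective uxs) uxs image⊆ ⊆image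
    where
    image⊆ : ∀ {z} → z ∈ map σ xs → z ∈ xs
    image⊆ z∈ with ∈-map⁻ σ z∈
    ... | x , x∈ , refl = into x∈
    ⊆image : ∀ {y} → y ∈ xs → y ∈ map σ xs
    ⊆image y∈ with onto y∈
    ... | x , x∈ , refl = ∈-map⁺ σ x∈

  unique-⊆⇒length-≤ : DecidableEquality A → {xs ys : List A} → Unique xs → Unique ys →
    (∀ {z} → z ∈ xs → z ∈ ys) → length xs ≤ length ys
  unique-⊆⇒length-≤ _≟_ {xs} {ys} uxs uys xs⊆ys =
    subst (length xs ≤_) (trans (sym (length-++ xs)) (↭-length xs++rest↭ys)) (ℕ.m≤m+n _ _)
    where
    open DecMembership _≟_ using (_∈?_)
    new? = λ y → ¬? (y ∈? xs)
    rest = filter new? ys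
    xs++rest↭ys : xs ++ rest ↭ ys
    xs++rest↭ys = unique⇒↭
      (Unique.++⁺ uxs (Unique.filter⁺ new? uys)
        λ (in-xs , in-rest) → proj₂ (∈-filter⁻ new? {xs = ys} in-rest) in-xs)
      uys ⊆ys ys⊆
      where
      ⊆ys : ∀ {z} → z ∈ xs ++ rest → z ∈ ys
      ⊆ys z∈ with ∈-++⁻ xs z∈
      ... | inj₁ in-xs   = xs⊆ys in-xs
      ... | inj₂ in-rest = proj₁ (∈-filter⁻ new? in-rest)
      ys⊆ : ∀ {z} → z ∈ ys → z ∈ xs ++ rest
      ys⊆ {z} z∈ with z ∈? xs
      ... | yes in-xs = ∈-++⁺ˡ in-xs
      ... | no ∉xs    = ∈-++⁺ʳ xs (∈-filter⁺ new? z∈ ∉xs)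

length-cartesianProduct : {A B : Set} (xs : List A) (ys : List B) →
  length (cartesianProduct xs ys) ≡ length xs ℕ.* length ys
length-cartesianProduct []       ys = refl
length-cartesianProduct (x ∷ xs) ys = trans (length-++ (map (x ,_) ys))
  (cong₂ ℕ._+_ (length-map (x ,_) ys) (length-cartesianProduct xs ys))

x≡-x⇒x≡0 : ∀ {x} → x ≡ -ℤ x → x ≡ ℤ.+ 0
x≡-x⇒x≡0 {ℤ.+ zero}     _  = refl
x≡-x⇒x≡0 {ℤ.+ suc n}    ()
x≡-x⇒x≡0 { -[1+ n ] } ()

-- Definitionally equal to Setup.sumℤ, but independent of the field.
sumℤ : List ℤ → ℤ
sumℤ = foldr _+ℤ_ (ℤ.+ 0)

sumℤ-↭ : {xs ys : List ℤ} → xs ↭ ys → sumℤ xs ≡ sumℤ ys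
sumℤ-↭ p = foldr-commMonoid (≡.setoid ℤ) ℤ.+-0-isCommutativeMonoid (↭⇒↭ₛ p)

sumℤ-++ : ∀ xs ys → sumℤ (xs ++ ys) ≡ sumℤ xs +ℤ sumℤ ys
sumℤ-++ []       ys = sym (ℤ.+-identityˡ _)
sumℤ-++ (x ∷ xs) ys = trans (cong (x +ℤ_) (sumℤ-++ xs ys)) (sym (ℤ.+-assoc x _ _))

module _ {A : Set} where

  sumℤ-map-cong : {h k : A → ℤ} (xs : List A) → (∀ {x} → x ∈ xs → h x ≡ k x) →
    sumℤ (map h xs) ≡ sumℤ (map k xs)
  sumℤ-map-cong []       h≗k = refl
  sumℤ-map-cong (x ∷ xs) h≗k = cong₂ _+ℤ_ (h≗k (here refl)) (sumℤ-map-cong xs (h≗k ∘ there))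

  sumℤ-map-neg : (h : A → ℤ) (xs : List A) → sumℤ (map (λ x → -ℤ h x) xs) ≡ -ℤ sumℤ (map h xs)
  sumℤ-map-neg h []       = refl
  sumℤ-map-neg h (x ∷ xs) = trans (cong (-ℤ h x +ℤ_) (sumℤ-map-neg h xs)) (sym (ℤ.neg-distrib-+ (h x) _))

  sumℤ-map-const-1 : (xs : List A) → sumℤ (map (λ _ → ℤ.+ 1) xs) ≡ ℤ.+ length xs
  sumℤ-map-const-1 []       = refl
  sumℤ-map-const-1 (x ∷ xs) = cong (ℤ.+ 1 +ℤ_) (sumℤ-map-const-1 xs)

  sumℤ-map-+1 : (h : A → ℤ) (xs : List A) →
    sumℤ (map h xs) +ℤ ℤ.+ length xs ≡ sumℤ (map (λ x → h x +ℤ ℤ.+ 1) xs)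
  sumℤ-map-+1 h []       = refl
  sumℤ-map-+1 h (x ∷ xs) = begin
    (h x +ℤ sumℤ (map h xs)) +ℤ (ℤ.+ 1 +ℤ ℤ.+ length xs)  ≡⟨ interchange (h x) _ _ _ ⟩
    (h x +ℤ ℤ.+ 1) +ℤ (sumℤ (map h xs) +ℤ ℤ.+ length xs)  ≡⟨ cong (λ z → (h x +ℤ ℤ.+ 1) +ℤ z) (sumℤ-map-+1 h xs) ⟩
    (h x +ℤ ℤ.+ 1) +ℤ sumℤ (map (λ x → h x +ℤ ℤ.+ 1) xs)  ∎
    where open CommutativeSemigroupProperties ℤ.+-commutativeSemigroup using (interchange)

  sumℤ-map-+ : (d : A → ℕ) (xs : List A) → sumℤ (map (λ x → ℤ.+ d x) xs) ≡ ℤ.+ sum (map d xs)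
  sumℤ-map-+ d []       = refl
  sumℤ-map-+ d (x ∷ xs) = cong (ℤ.+ d x +ℤ_) (sumℤ-map-+ d xs)

m*n≡o*p⇒p≤n⇒m≤o : (m n o p : ℕ) .{{_ : NonZero p}} → m ℕ.* n ≡ o ℕ.* p → p ≤ n → m ≤ o
m*n≡o*p⇒p≤n⇒m≤o m n o p mn≡op p≤n =
  ℕ.*-cancelʳ-≤ m o n {{ℕ.>-nonZero (ℕ.<-≤-trans (ℕ.>-nonZero⁻¹ p) p≤n)}}
    (subst (ℕ._≤ o ℕ.* n) (sym mn≡op) (ℕ.*-monoʳ-≤ o p≤n))

m*m≤n*n⇒m≤n : ∀ {m n} → m ℕ.* m ≤ n ℕ.* n → m ≤ n
m*m≤n*n⇒m≤n {m} {n} mm≤nn with m ℕ.≤? n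
... | yes m≤n = m≤n
... | no m≰n  = ⊥-elim (ℕ.<⇒≱ (ℕ.*-mono-< (ℕ.≰⇒> m≰n) (ℕ.≰⇒> m≰n)) mm≤nn)

-- Since q² − 1 = (q + 1)(q − 1) and q − 1 ≤ r.
q*q≡1+s*r⇒s≤1+q : ∀ q r s → 2 ≤ q → q ≤ suc r → q ℕ.* q ≡ suc (s ℕ.* r) → s ≤ suc q
q*q≡1+s*r⇒s≤1+q (suc p) r s (s≤s 1≤p) (s≤s p≤r) qq≡1+sr =
  m*n≡o*p⇒p≤n⇒m≤o s r (suc (suc p)) p {{ℕ.>-nonZero 1≤p}}
    (ℕ.suc-injective (trans (sym qq≡1+sr) (square-expansion p))) p≤r
  where
  square-expansion : ∀ p → suc p ℕ.* suc p ≡ suc (suc (suc p) ℕ.* p)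
  square-expansion = ℕ-Solver.solve-∀

+m≡-+n⇒n≡0 : ∀ {m n} → ℤ.+ m ≡ -ℤ ℤ.+ n → n ≡ 0
+m≡-+n⇒n≡0 {n = zero} _ = refl

-ℤ+m+n≡+k⇒n≡k+m : ∀ {m n k} → -ℤ ℤ.+ m +ℤ ℤ.+ n ≡ ℤ.+ k → n ≡ k ℕ.+ m
-ℤ+m+n≡+k⇒n≡k+m {m} {n} {k} eq = ℤ.+-injective (begin
  ℤ.+ n                            ≡⟨ cancel (ℤ.+ m) (ℤ.+ n) ⟩
  (-ℤ ℤ.+ m +ℤ ℤ.+ n) +ℤ ℤ.+ m     ≡⟨ cong (_+ℤ ℤ.+ m) eq ⟩
  ℤ.+ k +ℤ ℤ.+ m                   ∎)
  where
  cancel : ∀ x y → y ≡ (-ℤ x +ℤ y) +ℤ x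
  cancel = ℤ-Solver.solve-∀

module _ {A : Set} (h : A → ℕ) where

  ∈⇒≤sum-map : ∀ {x xs} → x ∈ xs → h x ≤ sum (map h xs)
  ∈⇒≤sum-map {xs = x ∷ xs} (here refl) = ℕ.m≤m+n (h x) _
  ∈⇒≤sum-map {xs = y ∷ xs} (there x∈) = ℕ.≤-trans (∈⇒≤sum-map x∈) (ℕ.m≤n+m _ (h y))

  sum-map-≡0 : ∀ xs → (∀ {x} → x ∈ xs → h x ≡ 0) → sum (map h xs) ≡ 0
  sum-map-≡0 []       _    = refl
  sum-map-≡0 (x ∷ xs) h≡0 = cong₂ ℕ._+_ (h≡0 (here refl)) (sum-map-≡0 xs (h≡0 ∘ there))

module _ {m : ℕ} (𝕂 : FiniteField2 m) where

  open FiniteField2 𝕂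
  open Setup 𝕂 hiding (sumℤ)

  private
    ring : CommutativeRing 0ℓ 0ℓ
    ring = record { isCommutativeRing = isCommutativeRing }

  open CommutativeRing ring
    using (+-assoc; +-comm; +-identityˡ; +-identityʳ; *-assoc; *-comm; *-identityˡ; *-identityʳ;
           distribˡ; distribʳ; zeroˡ; zeroʳ; *-isCommutativeMonoid; +-commutativeSemigroup; *-commutativeSemigroup)
  open CommutativeSemigroupProperties +-commutativeSemigroup
    using () renaming (interchange to +-interchange)
  open CommutativeSemigroupProperties *-commutativeSemigroup
    using () renaming (interchange to *-interchange)

  q : ℕ
  q = qℕ m

  x+x≡0 : ∀ x → x + x ≡ 0#
  x+x≡0 x = begin
    x + x              ≡⟨ cong₂ _+_ (*-identityʳ x) (*-identityʳ x) ⟨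
    x * 1# + x * 1#    ≡⟨ distribˡ x 1# 1# ⟨
    x * (1# + 1#)      ≡⟨ cong (x *_) char2 ⟩
    x * 0#             ≡⟨ zeroʳ x ⟩
    0#                 ∎

  x+y+y≡x : ∀ x y → (x + y) + y ≡ x
  x+y+y≡x x y = trans (+-assoc x y y) (trans (cong (_+_ x) (x+x≡0 y)) (+-identityʳ x))

  x+y≡0⇒x≡y : ∀ {x y} → x + y ≡ 0# → x ≡ y
  x+y≡0⇒x≡y {x} {y} x+y≡0 = begin
    x            ≡⟨ x+y+y≡x x y ⟨
    (x + y) + y  ≡⟨ cong (_+ y) x+y≡0 ⟩
    0# + y       ≡⟨ +-identityˡ y ⟩
    y            ∎

  x≡y⇒x+y≡0 : ∀ {x y} → x ≡ y → x + y ≡ 0#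
  x≡y⇒x+y≡0 {x} refl = x+x≡0 x

  +-injectiveʳ : ∀ c {x y} → x + c ≡ y + c → x ≡ y
  +-injectiveʳ c {x} {y} e = trans (sym (x+y+y≡x x c)) (trans (cong (_+ c) e) (x+y+y≡x y c))

  inv : ∀ x → x ≢ 0# → Carrier
  inv x x≢0 = proj₁ (inverse x x≢0)

  x*inv≡1 : ∀ x (x≢0 : x ≢ 0#) → x * inv x x≢0 ≡ 1#
  x*inv≡1 x x≢0 = proj₂ (inverse x x≢0)

  *-cancelˡ : ∀ {x y z} → x ≢ 0# → x * y ≡ x * z → y ≡ z
  *-cancelˡ {x} {y} {z} x≢0 xy≡xz = begin
    y                ≡⟨ *-identityˡ y ⟨
    1# * y           ≡⟨ cong (_* y) (trans (sym (x*inv≡1 x x≢0)) (*-comm x x⁻¹)) ⟩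
    (x⁻¹ * x) * y    ≡⟨ *-assoc x⁻¹ x y ⟩
    x⁻¹ * (x * y)    ≡⟨ cong (x⁻¹ *_) xy≡xz ⟩
    x⁻¹ * (x * z)    ≡⟨ *-assoc x⁻¹ x z ⟨
    (x⁻¹ * x) * z    ≡⟨ cong (_* z) (trans (*-comm x⁻¹ x) (x*inv≡1 x x≢0)) ⟩
    1# * z           ≡⟨ *-identityˡ z ⟩
    z                ∎
    where x⁻¹ = inv x x≢0

  *-cancelʳ : ∀ {x y z} → x ≢ 0# → y * x ≡ z * x → y ≡ z
  *-cancelʳ {x} {y} {z} x≢0 e = *-cancelˡ x≢0 (trans (*-comm x y) (trans e (*-comm z x)))

  *-nonzero : ∀ {x y} → x ≢ 0# → y ≢ 0# → x * y ≢ 0#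
  *-nonzero {x} {y} x≢0 y≢0 xy≡0 = y≢0 (*-cancelˡ x≢0 (trans xy≡0 (sym (zeroʳ x))))

  inv-nonzero : ∀ x (x≢0 : x ≢ 0#) → inv x x≢0 ≢ 0#
  inv-nonzero x x≢0 x⁻¹≡0 = 0≢1 (trans (sym (zeroʳ x)) (trans (cong (x *_) (sym x⁻¹≡0)) (x*inv≡1 x x≢0)))

  x*[inv*y]≡y : ∀ x (x≢0 : x ≢ 0#) y → x * (inv x x≢0 * y) ≡ y
  x*[inv*y]≡y x x≢0 y = trans (sym (*-assoc x _ y)) (trans (cong (_* y) (x*inv≡1 x x≢0)) (*-identityˡ y))

  ^-+ : ∀ x a b → x ^ (a ℕ.+ b) ≡ x ^ a * x ^ b
  ^-+ x zero    b = sym (*-identityˡ _)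
  ^-+ x (suc a) b = trans (cong (x *_) (^-+ x a b)) (sym (*-assoc x _ _))

  ^-* : ∀ x a b → x ^ (a ℕ.* b) ≡ (x ^ b) ^ a
  ^-* x zero    b = refl
  ^-* x (suc a) b = trans (^-+ x b (a ℕ.* b)) (cong (x ^ b *_) (^-* x a b))

  ^-comm : ∀ x a b → (x ^ a) ^ b ≡ (x ^ b) ^ a
  ^-comm x a b = trans (sym (^-* x b a)) (trans (cong (x ^_) (ℕ.*-comm b a)) (^-* x a b))

  *-^ : ∀ x y n → (x * y) ^ n ≡ x ^ n * y ^ n
  *-^ x y zero    = sym (*-identityˡ 1#)
  *-^ x y (suc n) = trans (cong ((x * y) *_) (*-^ x y n)) (*-interchange x y _ _)

  1^ : ∀ n → 1# ^ n ≡ 1#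
  1^ zero    = refl
  1^ (suc n) = trans (*-identityˡ _) (1^ n)

  0^ : ∀ n .{{_ : NonZero n}} → 0# ^ n ≡ 0#
  0^ (suc n) = zeroˡ _

  x^2≡x*x : ∀ x → x ^ 2 ≡ x * x
  x^2≡x*x x = cong (x *_) (*-identityʳ x)

  ^2-distrib-+ : ∀ x y → (x + y) ^ 2 ≡ x ^ 2 + y ^ 2
  ^2-distrib-+ x y = begin
    (x + y) ^ 2                        ≡⟨ x^2≡x*x (x + y) ⟩
    (x + y) * (x + y)                  ≡⟨ distribʳ (x + y) x y ⟩
    x * (x + y) + y * (x + y)          ≡⟨ cong₂ _+_ (distribˡ x x y) (distribˡ y x y) ⟩
    (x * x + x * y) + (y * x + y * y)  ≡⟨ +-interchange (x * x) (x * y) (y * x) (y * y) ⟩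
    (x * x + y * x) + (x * y + y * y)  ≡⟨ cong (λ z → (x * x + z) + (x * y + y * y)) (*-comm y x) ⟩
    (x * x + x * y) + (x * y + y * y)  ≡⟨ +-assoc (x * x) (x * y) _ ⟩
    x * x + (x * y + (x * y + y * y))  ≡⟨ cong (_+_ (x * x)) (+-assoc (x * y) (x * y) _) ⟨
    x * x + ((x * y + x * y) + y * y)  ≡⟨ cong (λ z → x * x + (z + y * y)) (x+x≡0 (x * y)) ⟩
    x * x + (0# + y * y)               ≡⟨ cong (_+_ (x * x)) (+-identityˡ _) ⟩
    x * x + y * y                      ≡⟨ cong₂ _+_ (x^2≡x*x x) (x^2≡x*x y) ⟨
    x ^ 2 + y ^ 2                      ∎

  frobenius : ℕ → Carrier → Carrier
  frobenius k x = x ^ (2 ℕ.^ k)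

  frobenius-suc : ∀ k x → frobenius (suc k) x ≡ frobenius k x ^ 2
  frobenius-suc k x = ^-* x 2 (2 ℕ.^ k)

  frobenius-+ : ∀ k x y → frobenius k (x + y) ≡ frobenius k x + frobenius k y
  frobenius-+ zero    x y = trans (*-identityʳ _) (sym (cong₂ _+_ (*-identityʳ x) (*-identityʳ y)))
  frobenius-+ (suc k) x y = begin
    frobenius (suc k) (x + y)                  ≡⟨ frobenius-suc k (x + y) ⟩
    frobenius k (x + y) ^ 2                    ≡⟨ cong (_^ 2) (frobenius-+ k x y) ⟩
    (frobenius k x + frobenius k y) ^ 2        ≡⟨ ^2-distrib-+ _ _ ⟩
    frobenius k x ^ 2 + frobenius k y ^ 2      ≡⟨ cong₂ _+_ (frobenius-suc k x) (frobenius-suc k y) ⟨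
    frobenius (suc k) x + frobenius (suc k) y  ∎

  frobenius-* : ∀ k x y → frobenius k (x * y) ≡ frobenius k x * frobenius k y
  frobenius-* k x y = *-^ x y (2 ℕ.^ k)

  frobenius-0 : ∀ k → frobenius k 0# ≡ 0#
  frobenius-0 k = 0^ (2 ℕ.^ k) {{ℕ.m^n≢0 2 k}}

  frobenius-1 : ∀ k → frobenius k 1# ≡ 1#
  frobenius-1 k = 1^ (2 ℕ.^ k)

  frobenius-+-∘ : ∀ a b x → frobenius (a ℕ.+ b) x ≡ frobenius a (frobenius b x)
  frobenius-+-∘ a b x = trans (cong (x ^_) (ℕ.^-distribˡ-+-* 2 a b)) (^-* x (2 ℕ.^ a) (2 ℕ.^ b))

  -- Fermat's little theorem

  nonzero? : ∀ y → Dec (y ≢ 0#)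
  nonzero? y = ¬? (y ≟ 0#)

  elems-↭-0∷ : {rest : List Carrier} → Unique rest → (∀ {y} → y ∈ rest → y ≢ 0#) →
    (∀ {y} → y ≢ 0# → y ∈ rest) → elems ↭ 0# ∷ rest
  elems-↭-0∷ {rest} u nonzero complete =
    unique⇒↭ elems-unique (All.tabulate (λ y∈ 0≡y → nonzero y∈ (sym 0≡y)) ∷ u)
      (λ {z} _ → 0∷rest-complete z) (λ _ → elems-complete _)
    where
    0∷rest-complete : ∀ z → z ∈ 0# ∷ rest
    0∷rest-complete z with z ≟ 0#
    ... | yes z≡0 = here z≡0
    ... | no z≢0  = there (complete z≢0)

  nonzeros : List Carrier
  nonzeros = filter nonzero? elems

  nonzeros-unique : Unique nonzeros
  nonzeros-unique = Unique.filter⁺ nonzero? elems-unique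

  ∈-nonzeros⁺ : ∀ {y} → y ≢ 0# → y ∈ nonzeros
  ∈-nonzeros⁺ y≢0 = ∈-filter⁺ nonzero? (elems-complete _) y≢0

  ∈-nonzeros⁻ : ∀ {y} → y ∈ nonzeros → y ≢ 0#
  ∈-nonzeros⁻ y∈ = proj₂ (∈-filter⁻ nonzero? {xs = elems} y∈)

  product : List Carrier → Carrier
  product = foldr _*_ 1#

  product-map-* : ∀ x ys → product (map (x *_) ys) ≡ x ^ length ys * product ys
  product-map-* x []       = sym (*-identityˡ 1#)
  product-map-* x (y ∷ ys) = trans (cong ((x * y) *_) (product-map-* x ys)) (*-interchange x y _ _)

  product-nonzero : ∀ ys → (∀ {y} → y ∈ ys → y ≢ 0#) → product ys ≢ 0#
  product-nonzero []       _       1≡0 = 0≢1 (sym 1≡0)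
  product-nonzero (y ∷ ys) nonzero = *-nonzero (nonzero (here refl)) (product-nonzero ys (nonzero ∘ there))

  -- Multiplication by x permutes the nonzero elements, so it fixes their product.
  x^|nonzeros|≡1 : ∀ x → x ≢ 0# → x ^ length nonzeros ≡ 1#
  x^|nonzeros|≡1 x x≢0 = *-cancelʳ (product-nonzero nonzeros ∈-nonzeros⁻) (begin
    x ^ length nonzeros * P      ≡⟨ product-map-* x nonzeros ⟨
    product (map (x *_) nonzeros) ≡⟨ foldr-commMonoid (≡.setoid _) *-isCommutativeMonoid (↭⇒↭ₛ x*-permutes) ⟩
    P                             ≡⟨ *-identityˡ P ⟨
    1# * P                        ∎)
    where
    P = product nonzeros
    x*-permutes : map (x *_) nonzeros ↭ nonzeros
    x*-permutes = map-↭-self (x *_) (*-cancelˡ x≢0) nonzeros-unique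
      (λ y∈ → ∈-nonzeros⁺ (*-nonzero x≢0 (∈-nonzeros⁻ y∈)))
      (λ {y} y∈ → inv x x≢0 * y , ∈-nonzeros⁺ (*-nonzero (inv-nonzero x x≢0) (∈-nonzeros⁻ y∈)) ,
                  x*[inv*y]≡y x x≢0 y)

  |elems|≡1+|nonzeros| : length elems ≡ suc (length nonzeros)
  |elems|≡1+|nonzeros| = ↭-length (elems-↭-0∷ nonzeros-unique ∈-nonzeros⁻ ∈-nonzeros⁺)

  fermat : ∀ x → x ^ (2 ℕ.^ (2 ℕ.* m)) ≡ x
  fermat x = begin
    x ^ (2 ℕ.^ (2 ℕ.* m))      ≡⟨ cong (x ^_) (trans (sym elems-size) |elems|≡1+|nonzeros|) ⟩
    x ^ suc (length nonzeros)  ≡⟨ x^1+|nonzeros|≡x (x ≟ 0#) ⟩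
    x                          ∎
    where
    x^1+|nonzeros|≡x : Dec (x ≡ 0#) → x ^ suc (length nonzeros) ≡ x
    x^1+|nonzeros|≡x (yes refl) = zeroˡ _
    x^1+|nonzeros|≡x (no x≢0)   = trans (cong (x *_) (x^|nonzeros|≡1 x x≢0)) (*-identityʳ x)

  2m≡m+m : 2 ℕ.* m ≡ m ℕ.+ m
  2m≡m+m = cong (m ℕ.+_) (ℕ.+-identityʳ m)

  conj-+ : ∀ x y → conj (x + y) ≡ conj x + conj y
  conj-+ = frobenius-+ m

  conj-* : ∀ x y → conj (x * y) ≡ conj x * conj y
  conj-* = frobenius-* m

  conj-involutive : ∀ x → conj (conj x) ≡ x
  conj-involutive x = trans (sym (frobenius-+-∘ m m x)) (subst (λ n → frobenius n x ≡ x) 2m≡m+m (fermat x))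

  conj-nonzero : ∀ {x} → x ≢ 0# → conj x ≢ 0#
  conj-nonzero {x} x≢0 x̄≡0 = x≢0 (trans (sym (conj-involutive x)) (trans (cong conj x̄≡0) (frobenius-0 m)))

  InF-0 : InF 0#
  InF-0 = frobenius-0 m

  InF-1 : InF 1#
  InF-1 = frobenius-1 m

  InF-+ : ∀ {x y} → InF x → InF y → InF (x + y)
  InF-+ {x} {y} x∈F y∈F = trans (conj-+ x y) (cong₂ _+_ x∈F y∈F)

  InF-* : ∀ {x y} → InF x → InF y → InF (x * y)
  InF-* {x} {y} x∈F y∈F = trans (conj-* x y) (cong₂ _*_ x∈F y∈F)

  InF-inv : ∀ {x} (x≢0 : x ≢ 0#) → InF x → InF (inv x x≢0)
  InF-inv {x} x≢0 x∈F = *-cancelˡ x≢0 (begin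
    x * conj x⁻¹       ≡⟨ cong (_* conj x⁻¹) x∈F ⟨
    conj x * conj x⁻¹  ≡⟨ conj-* x x⁻¹ ⟨
    conj (x * x⁻¹)     ≡⟨ cong conj (x*inv≡1 x x≢0) ⟩
    conj 1#            ≡⟨ InF-1 ⟩
    1#                 ≡⟨ x*inv≡1 x x≢0 ⟨
    x * x⁻¹            ∎)
    where x⁻¹ = inv x x≢0

  InF-T : ∀ x → InF (T x)
  InF-T x = trans (conj-+ x (conj x)) (trans (cong (_+_ (conj x)) (conj-involutive x)) (+-comm _ _))

  InF-norm : ∀ x → InF (x * conj x)
  InF-norm x = trans (conj-* x (conj x)) (trans (cong (conj x *_) (conj-involutive x)) (*-comm _ _))

  T-+ : ∀ x y → T (x + y) ≡ T x + T y
  T-+ x y = trans (cong (_+_ (x + y)) (conj-+ x y)) (+-interchange x y _ _)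

  T-linear : ∀ {l} y → InF l → T (l * y) ≡ l * T y
  T-linear {l} y l∈F = begin
    l * y + conj (l * y)       ≡⟨ cong (_+_ (l * y)) (conj-* l y) ⟩
    l * y + conj l * conj y    ≡⟨ cong (λ z → l * y + z * conj y) l∈F ⟩
    l * y + l * conj y         ≡⟨ distribˡ l y (conj y) ⟨
    l * (y + conj y)           ∎

  T-0 : T 0# ≡ 0#
  T-0 = trans (cong (_+_ 0#) InF-0) (+-identityˡ 0#)

  traceSum-+ : ∀ n x y → traceSum n (x + y) ≡ traceSum n x + traceSum n y
  traceSum-+ zero    x y = sym (+-identityˡ 0#)
  traceSum-+ (suc n) x y = trans (cong₂ _+_ (frobenius-+ n x y) (traceSum-+ n x y)) (+-interchange _ _ _ _)

  traceSum-0 : ∀ n → traceSum n 0# ≡ 0#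
  traceSum-0 zero    = refl
  traceSum-0 (suc n) = trans (cong₂ _+_ (frobenius-0 n) (traceSum-0 n)) (+-identityˡ 0#)

  traceSum-split : ∀ n k x → traceSum (n ℕ.+ k) x ≡ traceSum n (frobenius k x) + traceSum k x
  traceSum-split zero    k x = sym (+-identityˡ _)
  traceSum-split (suc n) k x = trans (cong₂ _+_ (frobenius-+-∘ n k x) (traceSum-split n k x)) (sym (+-assoc _ _ _))

  traceSum-squared : ∀ n y → traceSum n y ^ 2 ≡ traceSum n y + (frobenius n y + y)
  traceSum-squared zero    y = trans (frobenius-0 1) (sym (trans (+-identityˡ _) (x≡y⇒x+y≡0 (*-identityʳ y))))
  traceSum-squared (suc n) y = begin
    (yₙ + t) ^ 2                 ≡⟨ ^2-distrib-+ yₙ t ⟩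
    yₙ ^ 2 + t ^ 2               ≡⟨ cong₂ _+_ (sym (frobenius-suc n y)) (traceSum-squared n y) ⟩
    yₙ₊₁ + (t + (yₙ + y))        ≡⟨ cong (_+_ yₙ₊₁) (+-assoc t yₙ y) ⟨
    yₙ₊₁ + ((t + yₙ) + y)        ≡⟨ cong (λ z → yₙ₊₁ + (z + y)) (+-comm t yₙ) ⟩
    yₙ₊₁ + ((yₙ + t) + y)        ≡⟨ +-assoc yₙ₊₁ _ y ⟨
    (yₙ₊₁ + (yₙ + t)) + y        ≡⟨ cong (_+ y) (+-comm yₙ₊₁ _) ⟩
    ((yₙ + t) + yₙ₊₁) + y        ≡⟨ +-assoc _ yₙ₊₁ y ⟩
    (yₙ + t) + (yₙ₊₁ + y)        ∎
    where
    yₙ = frobenius n y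
    yₙ₊₁ = frobenius (suc n) y
    t = traceSum n y

  Tr≡tr∘T : ∀ x → Tr x ≡ tr (T x)
  Tr≡tr∘T x = cong toF2 (begin
    traceSum (2 ℕ.* m) x                ≡⟨ cong (λ n → traceSum n x) 2m≡m+m ⟩
    traceSum (m ℕ.+ m) x                ≡⟨ traceSum-split m m x ⟩
    traceSum m (conj x) + traceSum m x  ≡⟨ +-comm _ _ ⟩
    traceSum m x + traceSum m (conj x)  ≡⟨ traceSum-+ m x (conj x) ⟨
    traceSum m (T x)                    ∎)

  IsBit : Carrier → Set
  IsBit z = z ≡ 0# ⊎ z ≡ 1#

  idempotent⇒IsBit : ∀ {z} → z * z ≡ z → IsBit z
  idempotent⇒IsBit {z} zz≡z with z ≟ 0#
  ... | yes z≡0 = inj₁ z≡0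
  ... | no z≢0  = inj₂ (*-cancelˡ z≢0 (trans zz≡z (sym (*-identityʳ z))))

  traceSum-IsBit : ∀ {y} → InF y → IsBit (traceSum m y)
  traceSum-IsBit {y} y∈F = idempotent⇒IsBit (begin
    t * t                ≡⟨ x^2≡x*x t ⟨
    t ^ 2                ≡⟨ traceSum-squared m y ⟩
    t + (conj y + y)     ≡⟨ cong (_+_ t) (x≡y⇒x+y≡0 y∈F) ⟩
    t + 0#               ≡⟨ +-identityʳ t ⟩
    t                    ∎)
    where t = traceSum m y

  toF2-0 : toF2 0# ≡ false
  toF2-0 with 0# ≟ 0#
  ... | yes _  = refl
  ... | no 0≢0 = ⊥-elim (0≢0 refl)

  toF2-1 : toF2 1# ≡ true
  toF2-1 with 1# ≟ 0#
  ... | yes 1≡0 = ⊥-elim (0≢1 (sym 1≡0))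
  ... | no _    = refl

  toF2-+ : ∀ {x y} → IsBit x → IsBit y → toF2 (x + y) ≡ toF2 x xor toF2 y
  toF2-+ (inj₁ refl) (inj₁ refl) = trans (cong toF2 (+-identityˡ 0#)) (trans toF2-0 (sym (cong₂ _xor_ toF2-0 toF2-0)))
  toF2-+ (inj₁ refl) (inj₂ refl) = trans (cong toF2 (+-identityˡ 1#)) (trans toF2-1 (sym (cong₂ _xor_ toF2-0 toF2-1)))
  toF2-+ (inj₂ refl) (inj₁ refl) = trans (cong toF2 (+-identityʳ 1#)) (trans toF2-1 (sym (cong₂ _xor_ toF2-1 toF2-0)))
  toF2-+ (inj₂ refl) (inj₂ refl) = trans (cong toF2 char2) (trans toF2-0 (sym (cong₂ _xor_ toF2-1 toF2-1)))

  tr-+ : ∀ {x y} → InF x → InF y → tr (x + y) ≡ tr x xor tr y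
  tr-+ {x} {y} x∈F y∈F = trans (cong toF2 (traceSum-+ m x y)) (toF2-+ (traceSum-IsBit x∈F) (traceSum-IsBit y∈F))

  tr-0 : tr 0# ≡ false
  tr-0 = trans (cong toF2 (traceSum-0 m)) toF2-0

  Tr-+ : ∀ x y → Tr (x + y) ≡ Tr x xor Tr y
  Tr-+ x y = begin
    Tr (x + y)             ≡⟨ Tr≡tr∘T (x + y) ⟩
    tr (T (x + y))         ≡⟨ cong tr (T-+ x y) ⟩
    tr (T x + T y)         ≡⟨ tr-+ (InF-T x) (InF-T y) ⟩
    tr (T x) xor tr (T y)  ≡⟨ cong₂ _xor_ (Tr≡tr∘T x) (Tr≡tr∘T y) ⟨
    Tr x xor Tr y          ∎

  Tr-0 : Tr 0# ≡ false
  Tr-0 = trans (Tr≡tr∘T 0#) (trans (cong tr T-0) tr-0)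

  -- Polar decomposition K* = F* · S

  x*x≡y*y⇒x≡y : ∀ {x y} → x * x ≡ y * y → x ≡ y
  x*x≡y*y⇒x≡y {x} {y} xx≡yy with (x + y) ≟ 0#
  ... | yes x+y≡0 = x+y≡0⇒x≡y x+y≡0
  ... | no x+y≢0  = ⊥-elim (*-nonzero x+y≢0 x+y≢0 (begin
    (x + y) * (x + y)  ≡⟨ x^2≡x*x (x + y) ⟨
    (x + y) ^ 2        ≡⟨ ^2-distrib-+ x y ⟩
    x ^ 2 + y ^ 2      ≡⟨ cong₂ _+_ (x^2≡x*x x) (x^2≡x*x y) ⟩
    x * x + y * y      ≡⟨ x≡y⇒x+y≡0 xx≡yy ⟩
    0#                 ∎))

  InS-1 : InS 1#
  InS-1 = trans (*-identityˡ _) InF-1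

  InS⇒nonzero : ∀ {u} → InS u → u ≢ 0#
  InS⇒nonzero {u} u∈S u≡0 = 0≢1 (trans (sym (zeroˡ (conj u))) (trans (cong (_* conj u) (sym u≡0)) u∈S))

  InF* : Carrier → Set
  InF* l = InF l × l ≢ 0#

  norm-polar : ∀ {l u} → InF l → InS u → (l * u) * conj (l * u) ≡ l * l
  norm-polar {l} {u} l∈F u∈S = begin
    (l * u) * conj (l * u)  ≡⟨ cong ((l * u) *_) (trans (conj-* l u) (cong (_* conj u) l∈F)) ⟩
    (l * u) * (l * conj u)  ≡⟨ *-interchange l u l (conj u) ⟩
    (l * l) * (u * conj u)  ≡⟨ cong ((l * l) *_) u∈S ⟩
    (l * l) * 1#            ≡⟨ *-identityʳ _ ⟩
    l * l                   ∎

  polar-unique : ∀ {l u l′ u′} → InF* l → InS u → InF l′ → InS u′ →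
    l * u ≡ l′ * u′ → l ≡ l′ × u ≡ u′
  polar-unique {l} {u} {l′} {u′} (l∈F , l≢0) u∈S l′∈F u′∈S lu≡l′u′ =
    l≡l′ , *-cancelˡ l≢0 (trans lu≡l′u′ (cong (_* u′) (sym l≡l′)))
    where
    l≡l′ : l ≡ l′
    l≡l′ = x*x≡y*y⇒x≡y (trans (sym (norm-polar l∈F u∈S))
             (trans (cong (λ z → z * conj z) lu≡l′u′) (norm-polar l′∈F u′∈S)))

  module _ {{m≢0 : NonZero m}} where

    -- Squaring has order 2m, so frobenius (2m − 1) inverts it.
    √ : Carrier → Carrier
    √ = frobenius (ℕ.pred (2 ℕ.* m))

    √-squared : ∀ y → √ y * √ y ≡ y
    √-squared y = begin
      √ y * √ y              ≡⟨ x^2≡x*x (√ y) ⟨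
      √ y ^ 2                ≡⟨ frobenius-suc k y ⟨
      frobenius (suc k) y    ≡⟨ cong (λ n → frobenius n y) (ℕ.suc-pred (2 ℕ.* m) {{ℕ.m*n≢0 2 m}}) ⟩
      frobenius (2 ℕ.* m) y  ≡⟨ fermat y ⟩
      y                      ∎
      where k = ℕ.pred (2 ℕ.* m)

    InF-√ : ∀ {y} → InF y → InF (√ y)
    InF-√ {y} y∈F = trans (^-comm y (2 ℕ.^ k) (2 ℕ.^ m)) (cong (_^ (2 ℕ.^ k)) y∈F)
      where k = ℕ.pred (2 ℕ.* m)

    -- The F-part of x is the square root of its norm x x̄.
    polar : ∀ {x} → x ≢ 0# → ∃ λ l → ∃ λ u → InF* l × InS u × x ≡ l * u
    polar {x} x≢0 =
      l , x * l⁻¹ , (l∈F , l≢0) , xl⁻¹∈S , sym (trans (cong (l *_) (*-comm x l⁻¹)) (x*[inv*y]≡y l l≢0 x))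
      where
      N = x * conj x
      l = √ N
      l∈F = InF-√ (InF-norm x)
      l≢0 : l ≢ 0#
      l≢0 l≡0 = *-nonzero x≢0 (conj-nonzero x≢0)
        (trans (sym (√-squared N)) (trans (cong (λ z → z * z) l≡0) (zeroˡ 0#)))
      l⁻¹ = inv l l≢0
      xl⁻¹∈S : InS (x * l⁻¹)
      xl⁻¹∈S = begin
        (x * l⁻¹) * conj (x * l⁻¹)  ≡⟨ cong ((x * l⁻¹) *_) (conj-* x l⁻¹) ⟩
        (x * l⁻¹) * (conj x * conj l⁻¹) ≡⟨ cong (λ z → (x * l⁻¹) * (conj x * z)) (InF-inv l≢0 l∈F) ⟩
        (x * l⁻¹) * (conj x * l⁻¹)  ≡⟨ *-interchange x l⁻¹ (conj x) l⁻¹ ⟩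
        N * (l⁻¹ * l⁻¹)             ≡⟨ cong (_* (l⁻¹ * l⁻¹)) (√-squared N) ⟨
        (l * l) * (l⁻¹ * l⁻¹)       ≡⟨ *-interchange l l l⁻¹ l⁻¹ ⟩
        (l * l⁻¹) * (l * l⁻¹)       ≡⟨ cong₂ _*_ (x*inv≡1 l l≢0) (x*inv≡1 l l≢0) ⟩
        1# * 1#                     ≡⟨ *-identityˡ 1# ⟩
        1#                          ∎

    InF*? : ∀ y → Dec (InF* y)
    InF*? y = (conj y ≟ y) ×-dec nonzero? y

    InS? : ∀ u → Dec (InS u)
    InS? u = (u * conj u) ≟ 1#

    F*-list : List Carrier
    F*-list = filter InF*? elems

    S-list : List Carrier
    S-list = filter InS? elems

    F*-list-unique : Unique F*-list
    F*-list-unique = Unique.filter⁺ InF*? elems-unique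

    S-list-unique : Unique S-list
    S-list-unique = Unique.filter⁺ InS? elems-unique

    ∈-F*-list⁺ : ∀ {y} → InF* y → y ∈ F*-list
    ∈-F*-list⁺ y∈F* = ∈-filter⁺ InF*? (elems-complete _) y∈F*

    ∈-F*-list⁻ : ∀ {y} → y ∈ F*-list → InF* y
    ∈-F*-list⁻ y∈ = proj₂ (∈-filter⁻ InF*? {xs = elems} y∈)

    ∈-S-list⁺ : ∀ {u} → InS u → u ∈ S-list
    ∈-S-list⁺ u∈S = ∈-filter⁺ InS? (elems-complete _) u∈S

    ∈-S-list⁻ : ∀ {u} → u ∈ S-list → InS u
    ∈-S-list⁻ u∈ = proj₂ (∈-filter⁻ InS? {xs = elems} u∈)

    F-list : List Carrier
    F-list = 0# ∷ F*-list

    F-list-unique : Unique F-list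
    F-list-unique = All.tabulate (λ y∈ 0≡y → proj₂ (∈-F*-list⁻ y∈) (sym 0≡y)) ∷ F*-list-unique

    ∈-F-list⁺ : ∀ {y} → InF y → y ∈ F-list
    ∈-F-list⁺ {y} y∈F with y ≟ 0#
    ... | yes refl = here refl
    ... | no y≢0   = there (∈-F*-list⁺ (y∈F , y≢0))

    ∈-F-list⁻ : ∀ {y} → y ∈ F-list → InF y
    ∈-F-list⁻ (here refl) = InF-0
    ∈-F-list⁻ (there y∈)  = proj₁ (∈-F*-list⁻ y∈)

    polarBlock : Carrier → List Carrier
    polarBlock u = map (_* u) F*-list

    polarBlocks : List Carrier → List Carrier
    polarBlocks []       = []
    polarBlocks (u ∷ us) = polarBlock u ++ polarBlocks us

    ∈-polarBlocks⁺ : ∀ us {l u} → InF* l → u ∈ us → l * u ∈ polarBlocks us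
    ∈-polarBlocks⁺ (u ∷ us) l∈F* (here refl) = ∈-++⁺ˡ (∈-map⁺ (_* u) (∈-F*-list⁺ l∈F*))
    ∈-polarBlocks⁺ (u ∷ us) l∈F* (there u∈)  = ∈-++⁺ʳ (polarBlock u) (∈-polarBlocks⁺ us l∈F* u∈)

    ∈-polarBlocks⁻ : ∀ us {z} → z ∈ polarBlocks us → ∃ λ l → ∃ λ u → InF* l × u ∈ us × z ≡ l * u
    ∈-polarBlocks⁻ (u ∷ us) z∈ with ∈-++⁻ (polarBlock u) z∈
    ... | inj₁ z∈block with ∈-map⁻ (_* u) z∈block
    ...   | l , l∈ , z≡lu = l , u , ∈-F*-list⁻ l∈ , here refl , z≡lu
    ∈-polarBlocks⁻ (u ∷ us) z∈ | inj₂ z∈rest with ∈-polarBlocks⁻ us z∈rest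
    ...   | l , u′ , l∈F* , u′∈ , z≡lu′ = l , u′ , l∈F* , there u′∈ , z≡lu′

    polarBlocks-unique : ∀ us → Unique us → (∀ {u} → u ∈ us → InS u) → Unique (polarBlocks us)
    polarBlocks-unique []       _            _    = []
    polarBlocks-unique (u ∷ us) (u∉us ∷ uus) ⊆S =
      Unique.++⁺ (Unique.map⁺ (*-cancelʳ (InS⇒nonzero u∈S)) F*-list-unique)
                 (polarBlocks-unique us uus (⊆S ∘ there)) disjoint
      where
      u∈S = ⊆S (here refl)
      disjoint : ∀ {z} → ¬ (z ∈ polarBlock u × z ∈ polarBlocks us)
      disjoint (z∈block , z∈rest) with ∈-map⁻ (_* u) z∈block | ∈-polarBlocks⁻ us z∈rest
      ... | l , l∈ , z≡lu | l′ , u′ , l′∈F* , u′∈ , z≡l′u′ = All.lookup u∉us u′∈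
        (proj₂ (polar-unique (∈-F*-list⁻ l∈) u∈S (proj₁ l′∈F*) (⊆S (there u′∈)) (trans (sym z≡lu) z≡l′u′)))

    elems-↭-0∷polarBlocks : elems ↭ 0# ∷ polarBlocks S-list
    elems-↭-0∷polarBlocks = elems-↭-0∷ (polarBlocks-unique S-list S-list-unique ∈-S-list⁻) nonzero complete
      where
      nonzero : ∀ {y} → y ∈ polarBlocks S-list → y ≢ 0#
      nonzero y∈ with ∈-polarBlocks⁻ S-list y∈
      ... | l , u , (_ , l≢0) , u∈ , refl = *-nonzero l≢0 (InS⇒nonzero (∈-S-list⁻ u∈))
      complete : ∀ {y} → y ≢ 0# → y ∈ polarBlocks S-list
      complete y≢0 with polar y≢0
      ... | l , u , l∈F* , u∈S , refl = ∈-polarBlocks⁺ S-list l∈F* (∈-S-list⁺ u∈S)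

    length-polarBlocks : ∀ us → length (polarBlocks us) ≡ length us ℕ.* length F*-list
    length-polarBlocks []       = refl
    length-polarBlocks (u ∷ us) =
      trans (length-++ (polarBlock u)) (cong₂ ℕ._+_ (length-map (_* u) F*-list) (length-polarBlocks us))

    sumℤ-polarBlocks : (h : Carrier → ℤ) (us : List Carrier) →
      sumℤ (map h (polarBlocks us)) ≡ sumℤ (map (λ u → sumℤ (map h (polarBlock u))) us)
    sumℤ-polarBlocks h []       = refl
    sumℤ-polarBlocks h (u ∷ us) = begin
      sumℤ (map h (polarBlock u ++ polarBlocks us))                ≡⟨ cong sumℤ (map-++ h (polarBlock u) _) ⟩
      sumℤ (map h (polarBlock u) ++ map h (polarBlocks us))        ≡⟨ sumℤ-++ (map h (polarBlock u)) _ ⟩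
      sumℤ (map h (polarBlock u)) +ℤ sumℤ (map h (polarBlocks us)) ≡⟨ cong (sumℤ (map h (polarBlock u)) +ℤ_)
                                                                        (sumℤ-polarBlocks h us) ⟩
      sumℤ (map h (polarBlock u)) +ℤ sumℤ (map (λ u → sumℤ (map h (polarBlock u))) us) ∎

    -- The size of S

    2≤q : 2 ≤ q
    2≤q = ℕ.^-monoʳ-≤ 2 (ℕ.>-nonZero⁻¹ m)

    |elems|≡q*q : length elems ≡ q ℕ.* q
    |elems|≡q*q = trans elems-size (trans (cong (2 ℕ.^_) 2m≡m+m) (ℕ.^-distribˡ-+-* 2 m m))

    q*q≡1+|S|*|F*| : q ℕ.* q ≡ suc (length S-list ℕ.* length F*-list)
    q*q≡1+|S|*|F*| = begin
      q ℕ.* q                                  ≡⟨ |elems|≡q*q ⟨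
      length elems                             ≡⟨ ↭-length elems-↭-0∷polarBlocks ⟩
      suc (length (polarBlocks S-list))        ≡⟨ cong suc (length-polarBlocks S-list) ⟩
      suc (length S-list ℕ.* length F*-list)   ∎

    T≡0⇒InF : ∀ {x} → T x ≡ 0# → InF x
    T≡0⇒InF Tx≡0 = sym (x+y≡0⇒x≡y Tx≡0)

    T-pair-injective : ∀ {ω x y} → conj ω ≢ ω → T x ≡ T y → T (ω * x) ≡ T (ω * y) → x ≡ y
    T-pair-injective {ω} {x} {y} ω∉F Tx≡Ty Tωx≡Tωy with (x + y) ≟ 0#
    ... | yes x+y≡0 = x+y≡0⇒x≡y x+y≡0
    ... | no x+y≢0  = ⊥-elim (ω∉F (*-cancelʳ x+y≢0 (begin
      conj ω * d       ≡⟨ cong (conj ω *_) d∈F ⟨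
      conj ω * conj d  ≡⟨ conj-* ω d ⟨
      conj (ω * d)     ≡⟨ ωd∈F ⟩
      ω * d            ∎)))
      where
      d = x + y
      d∈F : InF d
      d∈F = T≡0⇒InF (trans (T-+ x y) (x≡y⇒x+y≡0 Tx≡Ty))
      ωd∈F : InF (ω * d)
      ωd∈F = T≡0⇒InF (trans (cong T (distribˡ ω x y)) (trans (T-+ (ω * x) (ω * y)) (x≡y⇒x+y≡0 Tωx≡Tωy)))

    q*q≤|F|*|F| : ∀ {ω} → conj ω ≢ ω → q ℕ.* q ≤ length F-list ℕ.* length F-list
    q*q≤|F|*|F| {ω} ω∉F = subst₂ _≤_
      (trans (length-map pair elems) |elems|≡q*q) (length-cartesianProduct F-list F-list)
      (unique-⊆⇒length-≤ (≡-dec _≟_ _≟_) (Unique.map⁺ pair-injective elems-unique)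
        (Unique.cartesianProduct⁺ F-list-unique F-list-unique) pair∈F×F)
      where
      pair : Carrier → Carrier × Carrier
      pair x = T x , T (ω * x)
      pair-injective : ∀ {x y} → pair x ≡ pair y → x ≡ y
      pair-injective eq = T-pair-injective ω∉F (cong proj₁ eq) (cong proj₂ eq)
      pair∈F×F : ∀ {z} → z ∈ map pair elems → z ∈ cartesianProduct F-list F-list
      pair∈F×F z∈ with ∈-map⁻ pair z∈
      ... | x , _ , refl = ∈-cartesianProduct⁺ (∈-F-list⁺ (InF-T x)) (∈-F-list⁺ (InF-T (ω * x)))

    K⊆F⇒|F|≡q*q : (∀ ω → InF ω) → length F-list ≡ q ℕ.* q
    K⊆F⇒|F|≡q*q K⊆F = trans (sym (↭-length elems↭F-list)) |elems|≡q*q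
      where
      elems↭F-list : elems ↭ F-list
      elems↭F-list = elems-↭-0∷ F*-list-unique (proj₂ ∘ ∈-F*-list⁻) (λ y≢0 → ∈-F*-list⁺ (K⊆F _ , y≢0))

    q≤|F| : q ≤ length F-list
    q≤|F| with any? (λ ω → ¬? (conj ω ≟ ω)) elems
    ... | yes ∃ω∉F = m*m≤n*n⇒m≤n (q*q≤|F|*|F| (proj₂ (satisfied ∃ω∉F)))
    ... | no ∄ω∉F  = subst (q ≤_) (sym (K⊆F⇒|F|≡q*q K⊆F)) (ℕ.m≤m*n q q {{ℕ.m^n≢0 2 m}})
      where
      K⊆F : ∀ ω → InF ω
      K⊆F ω with conj ω ≟ ω
      ... | yes ω∈F = ω∈F
      ... | no ω∉F  = ⊥-elim (∄ω∉F (lose (elems-complete ω) ω∉F))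

    |S|≤1+q : length S-list ≤ suc q
    |S|≤1+q = q*q≡1+s*r⇒s≤1+q q (length F*-list) (length S-list) 2≤q q≤|F| q*q≡1+|S|*|F*|

    -- Additive characters of F

    charSum : Carrier → ℤ
    charSum a = sumℤ (map (λ l → sgn (tr (l * a))) F-list)

    charSum-0 : charSum 0# ≡ ℤ.+ length F-list
    charSum-0 = trans (sumℤ-map-cong F-list (λ {l} _ → cong sgn (trans (cong tr (zeroʳ l)) tr-0)))
                      (sumℤ-map-const-1 F-list)

    module _ {λ₀ : Carrier} (λ₀∈F : InF λ₀) (trλ₀≡1 : tr λ₀ ≡ true) where

      -- Translation by λ₀ permutes F and flips the sign of every term.
      sum-sgn-tr-F≡0 : sumℤ (map (sgn ∘ tr) F-list) ≡ ℤ.+ 0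
      sum-sgn-tr-F≡0 = x≡-x⇒x≡0 (begin
        sumℤ (map (sgn ∘ tr) F-list)                  ≡⟨ sumℤ-↭ (↭.map⁺ (sgn ∘ tr) +λ₀-permutes) ⟨
        sumℤ (map (sgn ∘ tr) (map (_+ λ₀) F-list))    ≡⟨ cong sumℤ (map-∘ {g = sgn ∘ tr} F-list) ⟨
        sumℤ (map (λ l → sgn (tr (l + λ₀))) F-list)   ≡⟨ sumℤ-map-cong F-list (sign-flips ∘ ∈-F-list⁻) ⟩
        sumℤ (map (λ l → -ℤ sgn (tr l)) F-list)       ≡⟨ sumℤ-map-neg (sgn ∘ tr) F-list ⟩
        -ℤ sumℤ (map (sgn ∘ tr) F-list)               ∎)
        where
        +λ₀-permutes : map (_+ λ₀) F-list ↭ F-list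
        +λ₀-permutes = map-↭-self (_+ λ₀) (+-injectiveʳ λ₀) F-list-unique
          (λ l∈ → ∈-F-list⁺ (InF-+ (∈-F-list⁻ l∈) λ₀∈F))
          (λ {y} y∈ → y + λ₀ , ∈-F-list⁺ (InF-+ (∈-F-list⁻ y∈) λ₀∈F) , x+y+y≡x y λ₀)
        sgn-xor-true : ∀ b → sgn (b xor true) ≡ -ℤ sgn b
        sgn-xor-true false = refl
        sgn-xor-true true  = refl
        sign-flips : ∀ {l} → InF l → sgn (tr (l + λ₀)) ≡ -ℤ sgn (tr l)
        sign-flips {l} l∈F =
          trans (cong sgn (trans (tr-+ l∈F λ₀∈F) (cong (tr l xor_) trλ₀≡1))) (sgn-xor-true (tr l))

      charSum-nonzero : ∀ {a} → InF a → a ≢ 0# → charSum a ≡ ℤ.+ 0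
      charSum-nonzero {a} a∈F a≢0 = begin
        charSum a                                  ≡⟨ cong sumℤ (map-∘ {g = sgn ∘ tr} F-list) ⟩
        sumℤ (map (sgn ∘ tr) (map (_* a) F-list))  ≡⟨ sumℤ-↭ (↭.map⁺ (sgn ∘ tr) *a-permutes) ⟩
        sumℤ (map (sgn ∘ tr) F-list)               ≡⟨ sum-sgn-tr-F≡0 ⟩
        ℤ.+ 0                                      ∎
        where
        *a-permutes : map (_* a) F-list ↭ F-list
        *a-permutes = map-↭-self (_* a) (*-cancelʳ a≢0) F-list-unique
          (λ l∈ → ∈-F-list⁺ (InF-* (∈-F-list⁻ l∈) a∈F))
          (λ {y} y∈ → inv a a≢0 * y , ∈-F-list⁺ (InF-* (InF-inv a≢0 a∈F) (∈-F-list⁻ y∈)) ,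
                      trans (*-comm _ a) (x*[inv*y]≡y a a≢0 y))

    walsh-twist : ∀ (h : Carrier → Bool) c b → W (λ x → h x xor Tr (c * x)) b ≡ W h (b + c)
    walsh-twist h c b = sumℤ-map-cong elems λ {x} _ → cong sgn (begin
      (h x xor Tr (c * x)) xor Tr (b * x)  ≡⟨ Bool.xor-assoc (h x) _ _ ⟩
      h x xor (Tr (c * x) xor Tr (b * x))  ≡⟨ cong (h x xor_) (Bool.xor-comm (Tr (c * x)) _) ⟩
      h x xor (Tr (b * x) xor Tr (c * x))  ≡⟨ cong (h x xor_) (Tr-+ (b * x) (c * x)) ⟨
      h x xor Tr (b * x + c * x)           ≡⟨ cong (λ y → h x xor Tr y) (distribʳ x b c) ⟨
      h x xor Tr ((b + c) * x)             ∎)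

    module _ {g : Carrier → Carrier} (g∈F : ∀ u → InS u → InF (g u)) {f : Carrier → Bool}
             (f-polar : ∀ l u → InF l → InS u → f (l * u) ≡ tr (l * g u)) (bent : Bent f) where

      f-0 : f 0# ≡ false
      f-0 = begin
        f 0#             ≡⟨ cong f (zeroˡ 1#) ⟨
        f (0# * 1#)      ≡⟨ f-polar 0# 1# InF-0 InS-1 ⟩
        tr (0# * g 1#)   ≡⟨ cong tr (zeroˡ (g 1#)) ⟩
        tr 0#            ≡⟨ tr-0 ⟩
        false            ∎

      -- Otherwise f would vanish identically, and W f 0 = q² would not be ± q.
      tr-nontrivial : ∃ λ λ₀ → InF λ₀ × tr λ₀ ≡ true
      tr-nontrivial with any? (λ l → (conj l ≟ l) ×-dec (tr l Bool.≟ true)) elems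
      ... | yes found = satisfied found
      ... | no none   = ⊥-elim (W-f-0-not-±q (bent 0#))
        where
        tr-vanishes : ∀ {l} → InF l → tr l ≡ false
        tr-vanishes {l} l∈F with tr l in trl≡
        ... | false = refl
        ... | true  = ⊥-elim (none (lose (elems-complete l) (l∈F , trl≡)))
        f-vanishes : ∀ x → f x ≡ false
        f-vanishes x with x ≟ 0#
        ... | yes refl = f-0
        ... | no x≢0 with polar x≢0
        ...   | l , u , (l∈F , _) , u∈S , refl =
          trans (f-polar l u l∈F u∈S) (tr-vanishes (InF-* l∈F (g∈F u u∈S)))
        W-f-0 : W f 0# ≡ ℤ.+ (q ℕ.* q)
        W-f-0 = begin
          W f 0#                         ≡⟨ sumℤ-map-cong elems (λ {x} _ → cong sgn (cong₂ _xor_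
                                              (f-vanishes x) (trans (cong Tr (zeroˡ x)) Tr-0))) ⟩
          sumℤ (map (λ _ → ℤ.+ 1) elems) ≡⟨ sumℤ-map-const-1 elems ⟩
          ℤ.+ length elems               ≡⟨ cong ℤ.+_ |elems|≡q*q ⟩
          ℤ.+ (q ℕ.* q)                  ∎
        W-f-0-not-±q : ¬ ((W f 0# ≡ ℤ.+ q) ⊎ (W f 0# ≡ -ℤ ℤ.+ q))
        W-f-0-not-±q (inj₁ W≡q)  =
          ℕ.<-irrefl (ℤ.+-injective (trans (sym W≡q) W-f-0)) (ℕ.m<m*n q q {{ℕ.m^n≢0 2 m}} 2≤q)
        W-f-0-not-±q (inj₂ W≡-q) =
          ℕ.<⇒≱ 2≤q (subst (_≤ 1) (sym (+m≡-+n⇒n≡0 (trans (sym W-f-0) W≡-q))) z≤n)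

      walshTerm : Carrier → Carrier → ℤ
      walshTerm b x = sgn (f x xor Tr (b * x))

      walshTerm-polar : ∀ b {l u} → InF l → InS u → walshTerm b (l * u) ≡ sgn (tr (l * (T (u * b) + g u)))
      walshTerm-polar b {l} {u} l∈F u∈S = cong sgn (begin
        f (l * u) xor Tr (b * (l * u))         ≡⟨ cong₂ _xor_ (f-polar l u l∈F u∈S) (cong Tr b[lu]≡l[ub]) ⟩
        tr (l * g u) xor Tr (l * (u * b))      ≡⟨ cong (tr (l * g u) xor_) (Tr≡tr∘T _) ⟩
        tr (l * g u) xor tr (T (l * (u * b)))  ≡⟨ cong (λ y → tr (l * g u) xor tr y) (T-linear (u * b) l∈F) ⟩
        tr (l * g u) xor tr (l * T (u * b))    ≡⟨ Bool.xor-comm (tr (l * g u)) _ ⟩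
        tr (l * T (u * b)) xor tr (l * g u)    ≡⟨ tr-+ (InF-* l∈F (InF-T _)) (InF-* l∈F (g∈F u u∈S)) ⟨
        tr (l * T (u * b) + l * g u)           ≡⟨ cong tr (distribˡ l _ _) ⟨
        tr (l * (T (u * b) + g u))             ∎)
        where
        b[lu]≡l[ub] : b * (l * u) ≡ l * (u * b)
        b[lu]≡l[ub] = trans (*-comm b (l * u)) (*-assoc l u b)

      walshBlock : Carrier → Carrier → ℤ
      walshBlock b u = sumℤ (map (walshTerm b) (polarBlock u))

      walsh-polar : ∀ b → W f b ≡ ℤ.+ 1 +ℤ sumℤ (map (walshBlock b) S-list)
      walsh-polar b = begin
        sumℤ (map (walshTerm b) elems)                ≡⟨ sumℤ-↭ (↭.map⁺ (walshTerm b) elems-↭-0∷polarBlocks) ⟩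
        walshTerm b 0# +ℤ sumℤ (map (walshTerm b) (polarBlocks S-list))
                                                      ≡⟨ cong₂ _+ℤ_ walshTerm-0 (sumℤ-polarBlocks (walshTerm b) S-list) ⟩
        ℤ.+ 1 +ℤ sumℤ (map (walshBlock b) S-list)     ∎
        where
        walshTerm-0 : walshTerm b 0# ≡ ℤ.+ 1
        walshTerm-0 = cong sgn (cong₂ _xor_ f-0 (trans (cong Tr (zeroʳ b)) Tr-0))

      walshBlock+1≡charSum : ∀ b {u} → InS u → walshBlock b u +ℤ ℤ.+ 1 ≡ charSum (T (u * b) + g u)
      walshBlock+1≡charSum b {u} u∈S = begin
        walshBlock b u +ℤ ℤ.+ 1                                   ≡⟨ ℤ.+-comm (walshBlock b u) _ ⟩
        ℤ.+ 1 +ℤ walshBlock b u                                   ≡⟨ cong (ℤ.+ 1 +ℤ_) (cong sumℤ (map-∘ F*-list)) ⟨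
        ℤ.+ 1 +ℤ sumℤ (map (walshTerm b ∘ (_* u)) F*-list)        ≡⟨ cong₂ _+ℤ_ 0-term (sumℤ-map-cong F*-list term-polar) ⟩
        charSum a                                                 ∎
        where
        a = T (u * b) + g u
        0-term : ℤ.+ 1 ≡ sgn (tr (0# * a))
        0-term = cong sgn (sym (trans (cong tr (zeroˡ a)) tr-0))
        term-polar : ∀ {l} → l ∈ F*-list → walshTerm b (l * u) ≡ sgn (tr (l * a))
        term-polar l∈ = walshTerm-polar b (proj₁ (∈-F*-list⁻ l∈)) u∈S

      -- T (u b) + g u ≡ 0 says that b lies on the line L(u, g u).
      incidence : Carrier → Carrier → ℕ
      incidence b u with (T (u * b) + g u) ≟ 0#
      ... | yes _ = length F-list
      ... | no _  = 0

      incidence-on : ∀ {b u} → T (u * b) + g u ≡ 0# → incidence b u ≡ length F-list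
      incidence-on {b} {u} b∈L with (T (u * b) + g u) ≟ 0#
      ... | yes _   = refl
      ... | no b∉L  = ⊥-elim (b∉L b∈L)

      incidence-off : ∀ {b u} → T (u * b) + g u ≢ 0# → incidence b u ≡ 0
      incidence-off {b} {u} b∉L with (T (u * b) + g u) ≟ 0#
      ... | yes b∈L = ⊥-elim (b∉L b∈L)
      ... | no _    = refl

      charSum≡incidence : ∀ b {u} → InS u → charSum (T (u * b) + g u) ≡ ℤ.+ incidence b u
      charSum≡incidence b {u} u∈S with (T (u * b) + g u) ≟ 0#
      ... | yes b∈L = trans (cong charSum b∈L) charSum-0
      ... | no b∉L  with tr-nontrivial
      ...   | _ , λ₀∈F , trλ₀≡1 = charSum-nonzero λ₀∈F trλ₀≡1 (InF-+ (InF-T (u * b)) (g∈F u u∈S)) b∉L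

      walsh-incidences : ∀ b → W f b +ℤ ℤ.+ length S-list ≡ ℤ.+ suc (sum (map (incidence b) S-list))
      walsh-incidences b = begin
        W f b +ℤ ℤ.+ |S|                                        ≡⟨ cong (_+ℤ ℤ.+ |S|) (walsh-polar b) ⟩
        (ℤ.+ 1 +ℤ sumℤ (map (walshBlock b) S-list)) +ℤ ℤ.+ |S|  ≡⟨ ℤ.+-assoc (ℤ.+ 1) (sumℤ (map (walshBlock b) S-list)) _ ⟩
        ℤ.+ 1 +ℤ (sumℤ (map (walshBlock b) S-list) +ℤ ℤ.+ |S|)  ≡⟨ cong (ℤ.+ 1 +ℤ_) (sumℤ-map-+1 (walshBlock b) S-list) ⟩
        ℤ.+ 1 +ℤ sumℤ (map (λ u → walshBlock b u +ℤ ℤ.+ 1) S-list) ≡⟨ cong (ℤ.+ 1 +ℤ_) (sumℤ-map-cong S-list block≡incidence) ⟩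
        ℤ.+ 1 +ℤ sumℤ (map (λ u → ℤ.+ incidence b u) S-list)    ≡⟨ cong (ℤ.+ 1 +ℤ_) (sumℤ-map-+ (incidence b) S-list) ⟩
        ℤ.+ suc (sum (map (incidence b) S-list))                ∎
        where
        |S| = length S-list
        block≡incidence : ∀ {u} → u ∈ S-list → walshBlock b u +ℤ ℤ.+ 1 ≡ ℤ.+ incidence b u
        block≡incidence u∈ = trans (walshBlock+1≡charSum b (∈-S-list⁻ u∈)) (charSum≡incidence b (∈-S-list⁻ u∈))

      -- In characteristic 2, τ_c is its own inverse.
      InE⇒on-line : ∀ {c b} → InE g c b → ∃ λ u → InS u × T (u * (b + c)) + g u ≡ 0#
      InE⇒on-line {c} {b} (u , u∈S , x , x∈L , b≡x+c) =
        u , u∈S , subst (λ y → T (u * y) + g u ≡ 0#) (sym (trans (cong (_+ c) b≡x+c) (x+y+y≡x x c))) x∈L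

      on-line⇒InE : ∀ {c b u} → InS u → T (u * (b + c)) + g u ≡ 0# → InE g c b
      on-line⇒InE {c} {b} {u} u∈S b+c∈L = u , u∈S , b + c , b+c∈L , sym (x+y+y≡x b c)

      walsh-on-E : ∀ {c b} → InE g c b → W f (b + c) ≡ ℤ.+ q
      walsh-on-E {c} {b} b∈E with InE⇒on-line b∈E | bent (b + c)
      ... | _           | inj₁ W≡q  = W≡q
      ... | u , u∈S , b+c∈L | inj₂ W≡-q = ⊥-elim (ℕ.<⇒≱ q+1<|S| |S|≤1+q)
        where
        incidences = sum (map (incidence (b + c)) S-list)
        1≤incidences : 1 ≤ incidences
        1≤incidences = ℕ.≤-trans (s≤s z≤n)
          (subst (_≤ incidences) (incidence-on b+c∈L) (∈⇒≤sum-map (incidence (b + c)) (∈-S-list⁺ u∈S)))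
        q+1<|S| : suc q < length S-list
        q+1<|S| = subst (suc q <_)
          (sym (-ℤ+m+n≡+k⇒n≡k+m (trans (cong (_+ℤ ℤ.+ length S-list) (sym W≡-q)) (walsh-incidences (b + c)))))
          (s≤s (ℕ.+-monoˡ-≤ q 1≤incidences))

      walsh-off-E : ∀ {c b} → ¬ InE g c b → W f (b + c) ≡ -ℤ ℤ.+ q
      walsh-off-E {c} {b} b∉E with bent (b + c)
      ... | inj₂ W≡-q = W≡-q
      ... | inj₁ W≡q  = ⊥-elim (ℕ.<⇒≱ 2≤q (subst (q ≤_) q+|S|≡1 (ℕ.m≤m+n q (length S-list))))
        where
        no-incidences : sum (map (incidence (b + c)) S-list) ≡ 0
        no-incidences = sum-map-≡0 (incidence (b + c)) S-list λ {u} u∈ →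
          incidence-off (λ b+c∈L → b∉E (on-line⇒InE (∈-S-list⁻ u∈) b+c∈L))
        q+|S|≡1 : q ℕ.+ length S-list ≡ 1
        q+|S|≡1 = ℤ.+-injective (trans (cong (_+ℤ ℤ.+ length S-list) (sym W≡q))
                    (trans (walsh-incidences (b + c)) (cong (λ n → ℤ.+ suc n) no-incidences)))

open import Data.Nat using (_≥_)
open import Data.Integer using (+_; -_)
open FiniteField2 using (Carrier; _*_)
open Setup using (InS; InF; tr; Tr; Bent; W; InE)

proposition3p3 : (m : ℕ) → m ≥ 1 → (𝕂 : FiniteField2 m) →
    (g : Carrier 𝕂 → Carrier 𝕂) → (∀ u → InS 𝕂 u → InF 𝕂 (g u)) →
    (f : Carrier 𝕂 → Bool) →
    (∀ l u → InF 𝕂 l → InS 𝕂 u → f (_*_ 𝕂 l u) ≡ tr 𝕂 (_*_ 𝕂 l (g u))) →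
    Bent 𝕂 f →
    (c : Carrier 𝕂) →
    (b : Carrier 𝕂) →
    (InE 𝕂 g c b → W 𝕂 (λ x → f x xor Tr 𝕂 (_*_ 𝕂 c x)) b ≡ + qℕ m) ×
    (¬ InE 𝕂 g c b → W 𝕂 (λ x → f x xor Tr 𝕂 (_*_ 𝕂 c x)) b ≡ - (+ qℕ m))
proposition3p3 m m≥1 𝕂 g g∈F f f-polar bent c b =
  (λ b∈E → trans (walsh-twist 𝕂 f c b) (walsh-on-E 𝕂 g∈F {f = f} f-polar bent b∈E)) ,
  (λ b∉E → trans (walsh-twist 𝕂 f c b) (walsh-off-E 𝕂 g∈F {f = f} f-polar bent b∉E))
  where instance
  m≢0 : NonZero m
  m≢0 = ℕ.>-nonZero m≥1
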